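{- Let $A$ be a finite alphabet and $\varphi\in\mathrm{FO}_A[\sim]$ a sentence. Then there is $B\in\mathbb{N}$ such that $\varphi$ is effectively equivalent (i.e., satisfied by exactly the same pairs $(\mathbb{P},w)$ of process triples and executions) to a disjunction of conjunctions of formulas of the form $\exists^{\bowtie m}y.\bigl(\theta(y)\wedge\psi_{B,\ell}(y)\bigr)$, where ${\bowtie}\in\{\ge,=\}$, $m\in\mathbb{N}$, $\theta\in\mathbb{T}$, and $\ell\in\{0,\dots,B\}^A$.
   Context: Process types: $\mathbb{T}=\{s,e,se\}$. A process triple $\mathbb{P}=(\mathbb{P}_s,\mathbb{P}_e,\mathbb{P}_{se})$ consists of pairwise disjoint finite sets; $A=A_s\uplus A_e$ is a finite alphabet; events are $\Sigma_s=A_s\times(\mathbb{P}_s\cup\mathbb{P}_{se})$, $\Sigma_e=A_e\times(\mathbb{P}_e\cup\mathbb{P}_{se})$, $\Sigma=\Sigma_s\cup\Sigma_e$; an execution is $w\in\Sigma^*\cup\Sigma^\omega$ with position set $\mathrm{Pos}(w)$. The logic $\mathrm{FO}_A[\sim]$ has atomic formulas $\theta(x)$ ($\theta\in\mathbb{T}$), $a(x)$ ($a\in A$), $x=y$, $x\sim y$, closed under $\neg,\vee,\exists$. It is evaluated over the structure with universe $\mathbb{P}\uplus\mathrm{Pos}(w)$, where $\theta$ denotes $\mathbb{P}_\theta$, $a$ denotes the positions $i$ whose event has action $a$, and $\sim$ is the least equivalence relation containing $(p,i)$ when position $i$ carries process $p$ and $(i,j)$ when positions $i,j$ carry the same process.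 For $m>0$, $\exists^{\ge m}y.\phi$ abbreviates $\exists y_1\dots\exists y_m.\bigwedge_{i<j}\neg(y_i=y_j)\wedge\bigwedge_i\phi(y_i)$, $\exists^{\ge 0}y.\phi=\mathit{true}$, and $\exists^{=m}y.\phi=\exists^{\ge m}y.\phi\wedge\neg\exists^{\ge m+1}y.\phi$. For $B\in\mathbb{N}$ and $\ell\in\{0,\dots,B\}^A$, $\psi_{B,\ell}(y)=\bigwedge_{a\in A,\ \ell(a)<B}\exists^{=\ell(a)}z.(y\sim z\wedge a(z))\ \wedge\ \bigwedge_{a\in A,\ \ell(a)=B}\exists^{\ge\ell(a)}z.(y\sim z\wedge a(z))$. -}

module Defs where

open import Data.Nat using (ℕ; zero; suc; _+_; _<ᵇ_; _≡ᵇ_)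
open import Data.Fin using (Fin; zero; suc; toℕ; _↑ˡ_; _↑ʳ_)
open import Data.List using (List; []; _∷_; map; concatMap; foldr; allFin)
open import Data.Bool using (Bool; true; false; if_then_else_)
open import Data.Sum using (_⊎_; inj₁; inj₂)
open import Data.Product using (Σ; _×_; _,_)
open import Data.Unit using (⊤)
open import Data.Empty using (⊥)
open import Relation.Nullary using (¬_)
open import Relation.Binary.PropositionalEquality using (_≡_)

data PType : Set where
  s e se : PType

data Side : Set where
  sideS sideE : Side

-- Σ_s = A_s × (P_s ∪ P_se),  Σ_e = A_e × (P_e ∪ P_se)
Compatible : Side → PType → Set
Compatible sideS s  = ⊤
Compatible sideS e  = ⊥
Compatible sideS se = ⊤
Compatible sideE s  = ⊥
Compatible sideE e  = ⊤
Compatible sideE se = ⊤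

-- Alphabet A = Fin nA, with  side : Fin nA → Side  giving A = A_s ⊎ A_e.
-- Process triple: processes Fin np, with  ptype : Fin np → PType,
-- i.e. P_θ = { p | ptype p ≡ θ } (pairwise disjoint finite sets).

data Len : Set where
  fin : ℕ → Len
  ω   : Len

Pos : Len → Set
Pos (fin n) = Fin n
Pos ω       = ℕ

record Execution {nA np : ℕ} (side : Fin nA → Side) (ptype : Fin np → PType) : Set where
  field
    len  : Len
    act  : Pos len → Fin nA
    proc : Pos len → Fin np
    ok   : ∀ i → Compatible (side (act i)) (ptype (proc i))
open Execution public

-- Syntax of FO_A[~], de Bruijn variables (n = number of free variables)

data Formula (nA : ℕ) (n : ℕ) : Set where
  typ : PType → Fin n → Formula nA n
  lab : Fin nA → Fin n → Formula nA n
  _≐_ : Fin n → Fin n → Formula nA n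
  _∼_ : Fin n → Fin n → Formula nA n
  ¬'  : Formula nA n → Formula nA n
  _∨'_ : Formula nA n → Formula nA n → Formula nA n
  ∃'  : Formula nA (suc n) → Formula nA n

module Semantics {nA np : ℕ} {side : Fin nA → Side} {ptype : Fin np → PType}
                 (w : Execution side ptype) where

  Elem : Set
  Elem = Fin np ⊎ Pos (len w)

  TypeAt : PType → Elem → Set
  TypeAt θ (inj₁ p) = ptype p ≡ θ
  TypeAt θ (inj₂ i) = ⊥

  LabAt : Fin nA → Elem → Set
  LabAt a (inj₁ p) = ⊥
  LabAt a (inj₂ i) = act w i ≡ a

  data _≈_ : Elem → Elem → Set where
    base-pi : ∀ {p i} → proc w i ≡ p → inj₁ p ≈ inj₂ i
    base-ij : ∀ {i j} → proc w i ≡ proc w j → inj₂ i ≈ inj₂ j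
    ≈-refl  : ∀ {x} → x ≈ x
    ≈-sym   : ∀ {x y} → x ≈ y → y ≈ x
    ≈-trans : ∀ {x y z} → x ≈ y → y ≈ z → x ≈ z

  Sat : ∀ {n} → Formula nA n → (Fin n → Elem) → Set
  Sat (typ θ x) ρ = TypeAt θ (ρ x)
  Sat (lab a x) ρ = LabAt a (ρ x)
  Sat (x ≐ y)   ρ = ρ x ≡ ρ y
  Sat (x ∼ y)   ρ = ρ x ≈ ρ y
  Sat (¬' φ)    ρ = ¬ Sat φ ρ
  Sat (φ ∨' ψ)  ρ = Sat φ ρ ⊎ Sat ψ ρ
  Sat (∃' φ)    ρ = Σ Elem λ d → Sat φ (λ { zero → d ; (suc x) → ρ x })

  _⊨_ : Formula nA 0 → Set
  _⊨_ φ = Sat φ (λ ())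

module _ {nA : ℕ} where

  rename : ∀ {n k} → (Fin n → Fin k) → Formula nA n → Formula nA k
  rename r (typ θ x) = typ θ (r x)
  rename r (lab a x) = lab a (r x)
  rename r (x ≐ y)   = r x ≐ r y
  rename r (x ∼ y)   = r x ∼ r y
  rename r (¬' φ)    = ¬' (rename r φ)
  rename r (φ ∨' ψ)  = rename r φ ∨' rename r ψ
  rename r (∃' φ)    = ∃' (rename (λ { zero → zero ; (suc x) → suc (r x) }) φ)

  _∧'_ : ∀ {n} → Formula nA n → Formula nA n → Formula nA n
  φ ∧' ψ = ¬' (¬' φ ∨' ¬' ψ)

  true' : ∀ {n} → Formula nA n
  true' = ¬' (∃' (¬' (zero ≐ zero)))

  false' : ∀ {n} → Formula nA n
  false' = ¬' true'

  ⋀ : ∀ {n} → List (Formula nA n) → Formula nA n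
  ⋀ []       = true'
  ⋀ (φ ∷ []) = φ
  ⋀ (φ ∷ φs) = φ ∧' ⋀ φs

  ⋁ : ∀ {n} → List (Formula nA n) → Formula nA n
  ⋁ []       = false'
  ⋁ (φ ∷ []) = φ
  ⋁ (φ ∷ φs) = φ ∨' ⋁ φs

  when : ∀ {X : Set} → Bool → X → List X
  when true  x = x ∷ []
  when false x = []

  ∃ⁿ : ∀ {n} (m : ℕ) → Formula nA (m + n) → Formula nA n
  ∃ⁿ zero    φ = φ
  ∃ⁿ (suc m) φ = ∃ⁿ m (∃' φ)

  -- ∃^{≥m} y. φ   (φ has y as its variable 0)
  -- = ∃y₁…∃y_m. ⋀_{i<j} ¬(y_i = y_j) ∧ ⋀_i φ(y_i);   ∃^{≥0} y. φ = true
  ∃≥ : ∀ {n} (m : ℕ) → Formula nA (suc n) → Formula nA n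
  ∃≥ zero    φ = true'
  ∃≥ {n} (suc k) φ =
    ∃ⁿ m ( ⋀ (concatMap (λ i → concatMap (λ j →
                 when (toℕ i <ᵇ toℕ j) (¬' ((i ↑ˡ n) ≐ (j ↑ˡ n))))
               (allFin m)) (allFin m))
        ∧' ⋀ (map (λ i → rename (λ { zero → i ↑ˡ n ; (suc x) → m ↑ʳ x }) φ)
                  (allFin m)) )
    where m = suc k

  ∃= : ∀ {n} (m : ℕ) → Formula nA (suc n) → Formula nA n
  ∃= m φ = ∃≥ m φ ∧' ¬' (∃≥ (suc m) φ)

  ψ : (B : ℕ) → (Fin nA → Fin (suc B)) → Formula nA 1
  ψ B ℓ =
       ⋀ (concatMap (λ a → when (toℕ (ℓ a) <ᵇ B)
            (∃= (toℕ (ℓ a)) ((suc zero ∼ zero) ∧' lab a zero))) (allFin nA))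
    ∧' ⋀ (concatMap (λ a → when (toℕ (ℓ a) ≡ᵇ B)
            (∃≥ (toℕ (ℓ a)) ((suc zero ∼ zero) ∧' lab a zero))) (allFin nA))

data Bowtie : Set where
  ≥' =' : Bowtie

record NFAtom (nA B : ℕ) : Set where
  constructor nfAtom
  field
    bowtie : Bowtie
    m      : ℕ
    θ      : PType
    ℓ      : Fin nA → Fin (suc B)

atomFormula : ∀ {nA B} → NFAtom nA B → Formula nA 0
atomFormula {B = B} (nfAtom ≥' m θ ℓ) = ∃≥ m (typ θ zero ∧' ψ B ℓ)
atomFormula {B = B} (nfAtom =' m θ ℓ) = ∃= m (typ θ zero ∧' ψ B ℓ)

NormalForm : ℕ → ℕ → Set
NormalForm nA B = List (List (NFAtom nA B))

nfFormula : ∀ {nA B} → NormalForm nA B → Formula nA 0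
nfFormula nf = ⋁ (map (λ c → ⋀ (map atomFormula c)) nf)

-- Let q be the quantifier rank of φ. Call two processes q-similar if they have the same type
-- and, for every action a, the same number of a-events up to threshold q. An
-- Ehrenfeucht–Fraïssé argument shows that two structures agree on all sentences of rank at
-- most q as soon as they have, up to threshold q, the same number of processes of every
-- similarity class: a move on an unpebbled element of a pebbled process is answered by an
-- element of the same kind in the corresponding process, and a move in a fresh process by
-- the same kind of element in a fresh process of the same similarity class; the thresholds
-- drop by one per round, which is why q suffices. A similarity class is a process type
-- together with a profile ℓ ∈ {0..q}^A, and the counts of the classes are exactly what the
-- formulas ∃^{⋈m} y. θ(y) ∧ ψ_{q,ℓ}(y) express. Every count function c is realised by a
-- finite canonical structure, on which φ is decidable, so φ is equivalent to the disjunction,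
-- over the c whose canonical structure satisfies φ, of the conjunctions describing c.
-- Excluded middle is used to read the derived connectives ∧, ∃^{=m} and to compare
-- arbitrary, possibly infinite, executions with the canonical structures.

module Submission where

open import Defs
open import Data.Bool using (Bool; true; false; T)
open import Data.Empty using (⊥-elim)
open import Data.Fin using (Fin; zero; suc; toℕ; fromℕ; inject₁; inject≤; punchIn; _↑ˡ_; _↑ʳ_; splitAt)
import Data.Fin.Properties as Finₚ
open import Data.Fin.Properties
  using (toℕ-injective; toℕ-fromℕ; toℕ-inject₁; toℕ≤pred[n]; inject≤-injective; punchIn-injective; punchInᵢ≢i;
         injective⇒≤; suc-injective)
open import Data.List using (List; []; _∷_; map; concatMap; allFin; cartesianProduct; filter)
open import Data.List.Membership.Propositional using (_∈_; find; lose)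
open import Data.List.Membership.Propositional.Properties
  using (∈-map⁺; ∈-concatMap⁺; ∈-allFin; ∈-cartesianProduct⁺; ∈-filter⁺; ∈-filter⁻)
open import Data.List.Relation.Unary.All as All using (All; []; _∷_)
import Data.List.Relation.Unary.All.Properties as Allₚ
open import Data.List.Relation.Unary.Any as Any using (Any; here; there; satisfied)
import Data.List.Relation.Unary.Any.Properties as Anyₚ
open import Data.Nat using (ℕ; zero; suc; _+_; _⊔_; _≤_; _<_; z≤n; s≤s; _<ᵇ_; _≡ᵇ_)
open import Data.Nat.Properties
  using (≤-refl; ≤-trans; ≤-antisym; n≤1+n; <-irrefl; <-≤-trans; ≮⇒≥; ≰⇒>; _<?_; _≤?_;
         m⊔n≤o⇒m≤o; m⊔n≤o⇒n≤o; <ᵇ⇒<; <⇒<ᵇ; ≡ᵇ⇒≡; ≡⇒≡ᵇ)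
open import Data.Product using (Σ; _×_; _,_; proj₁; proj₂; map₂; uncurry)
open import Data.Product.Function.NonDependent.Propositional using (_×-⇔_)
import Data.Product.Properties as Σₚ
open import Data.Sum using (_⊎_; inj₁; inj₂; [_,_])
open import Data.Sum.Function.Propositional using (_⊎-⇔_)
import Data.Sum.Properties as ⊎ₚ
open import Data.Unit using (tt)
open import Data.Vec using (Vec; []; _∷_; lookup; tabulate)
import Data.Vec.Properties as Vecₚ
open import Data.Vec.Functional using (_++_) renaming (_∷_ to _∷ᵥ_; [] to []ᵥ)
open import Data.Vec.Functional.Properties using (lookup-++ˡ; lookup-++ʳ)
open import Function using (_∘_; id)
open import Function.Bundles using (_⇔_; mk⇔; Equivalence)
open import Function.Definitions using (Injective)
import Function.Properties.Equivalence as ⇔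
open import Function.Properties.Inverse using (↔⇒⇔)
open import Function.Related.TypeIsomorphisms using (¬-cong-⇔; →-cong-⇔)
open import Level using (0ℓ)
open import Axiom.DoubleNegationElimination using (em⇒dne)
open import Axiom.ExcludedMiddle using (ExcludedMiddle)
open import Relation.Binary.Definitions using (DecidableEquality; tri<; tri≈; tri>)
open import Relation.Binary.PropositionalEquality
  using (_≡_; _≢_; _≗_; refl; sym; trans; cong; subst; subst₂; module ≡-Reasoning)
import Relation.Binary.Reasoning.Setoid as SetoidReasoning
open import Relation.Nullary using (¬_; Dec; yes; no; ¬?)
open import Relation.Nullary.Decidable using (_⊎-dec_) renaming (map to Dec-map)
open import Relation.Unary using (Pred; Decidable; _⊆_; _∩_; ∁) renaming (_≐_ to _≐′_)

open Equivalence using (to; from)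

module ⇔-Reasoning = SetoidReasoning (⇔.⇔-setoid 0ℓ)

private
  variable
    X Y Z : Set
    i j k : ℕ

≡-⇔ : {A : Set} {a b : A} (c : A) → a ≡ b → (a ≡ c) ⇔ (b ≡ c)
≡-⇔ c refl = ⇔.refl

≡-⇔₂ : {A : Set} {a a′ b b′ : A} → a ≡ a′ → b ≡ b′ → (a ≡ b) ⇔ (a′ ≡ b′)
≡-⇔₂ refl refl = ⇔.refl

∃-cong : {P Q : Pred X 0ℓ} → (∀ x → P x ⇔ Q x) → Σ X P ⇔ Σ X Q
∃-cong P⇔Q = mk⇔ (map₂ (to (P⇔Q _))) (map₂ (from (P⇔Q _)))

∀-cong : {P Q : Pred X 0ℓ} → (∀ x → P x ⇔ Q x) → (∀ x → P x) ⇔ (∀ x → Q x)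
∀-cong P⇔Q = mk⇔ (λ h x → to (P⇔Q x) (h x)) (λ h x → from (P⇔Q x) (h x))

≐′-from-⇔ : {P Q : Pred X 0ℓ} → (∀ x → P x ⇔ Q x) → P ≐′ Q
≐′-from-⇔ P⇔Q = (λ {x} → to (P⇔Q x)) , (λ {x} → from (P⇔Q x))

All-when : {nA : ℕ} {P : Pred X 0ℓ} (b : Bool) {x : X} → All P (when {nA} b x) ⇔ (T b → P x)
All-when true  = mk⇔ (λ { (Px ∷ []) _ → Px }) (λ Px → Px tt ∷ [])
All-when false = mk⇔ (λ _ ()) (λ _ → [])

All-concatMap-allFin : ∀ {n} {P : Pred X 0ℓ} (f : Fin n → List X) →
                       All P (concatMap f (allFin n)) ⇔ (∀ i → All P (f i))
All-concatMap-allFin f =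
  mk⇔ (Allₚ.tabulate⁻ ∘ Allₚ.map⁻ ∘ Allₚ.concat⁻) (Allₚ.concat⁺ ∘ Allₚ.map⁺ ∘ Allₚ.tabulate⁺)

All-map-allFin : ∀ {n} {P : Pred X 0ℓ} (f : Fin n → X) → All P (map f (allFin n)) ⇔ (∀ i → P (f i))
All-map-allFin f = mk⇔ (Allₚ.tabulate⁻ ∘ Allₚ.map⁻) (Allₚ.map⁺ ∘ Allₚ.tabulate⁺)

All-complete : {P : Pred X 0ℓ} {xs : List X} → (∀ x → x ∈ xs) → All P xs ⇔ (∀ x → P x)
All-complete complete = mk⇔ (λ all x → All.lookup all (complete x)) (λ h → All.tabulate λ {x} _ → h x)

Any⇔∈ : {P : Pred X 0ℓ} {xs : List X} → Any P xs ⇔ Σ X (λ x → x ∈ xs × P x)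
Any⇔∈ = mk⇔ find (λ (_ , x∈xs , Px) → lose x∈xs Px)

++-head-tail : ∀ {m n} (τ : Fin (suc m) → X) (ρ : Fin n → X) → (τ ++ ρ) ≗ (τ zero ∷ᵥ (τ ∘ suc ++ ρ))
++-head-tail         τ ρ zero    = refl
++-head-tail {m = m} τ ρ (suc i) = ⊎ₚ.[,]-map (splitAt m i)

<-distinct⇔Injective : ∀ {m} (τ : Fin m → X) →
                       (∀ i j → toℕ i < toℕ j → τ i ≢ τ j) ⇔ Injective _≡_ _≡_ τ
<-distinct⇔Injective τ = mk⇔ injective distinct
  where
  injective : (∀ i j → toℕ i < toℕ j → τ i ≢ τ j) → Injective _≡_ _≡_ τ
  injective τ-distinct {i} {j} τi≡τj with Finₚ.<-cmp i j
  ... | tri< i<j _ _ = ⊥-elim (τ-distinct i j i<j τi≡τj)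
  ... | tri≈ _ i≡j _ = i≡j
  ... | tri> _ _ j<i = ⊥-elim (τ-distinct j i j<i (sym τi≡τj))
  distinct : Injective _≡_ _≡_ τ → ∀ i j → toℕ i < toℕ j → τ i ≢ τ j
  distinct τ-injective i j i<j τi≡τj = Finₚ.<-irrefl (τ-injective τi≡τj) i<j

-- Counting up to a threshold

record AtLeast {X : Set} (j : ℕ) (Q : Pred X 0ℓ) : Set where
  constructor atLeast
  field
    witness           : Fin j → X
    witness-injective : Injective _≡_ _≡_ witness
    witness-sat       : ∀ i → Q (witness i)

Exactly : ℕ → Pred X 0ℓ → Set
Exactly n Q = AtLeast n Q × ¬ AtLeast (suc n) Q

Without : Pred X 0ℓ → X → Pred X 0ℓ
Without Q x y = Q y × y ≢ x

Without-¬ : {Q : Pred X 0ℓ} {x : X} → ¬ Q x → Q ≐′ Without Q x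
Without-¬ ¬Qx = (λ Qy → Qy , λ { refl → ¬Qx Qy }) , proj₁

AtLeast-mono : {Q Q′ : Pred X 0ℓ} → Q ⊆ Q′ → AtLeast j Q → AtLeast j Q′
AtLeast-mono Q⊆Q′ (atLeast f f-inj f-sat) = atLeast f f-inj (Q⊆Q′ ∘ f-sat)

AtLeast-cong : {Q Q′ : Pred X 0ℓ} → Q ≐′ Q′ → AtLeast j Q ⇔ AtLeast j Q′
AtLeast-cong (Q⊆Q′ , Q′⊆Q) = mk⇔ (AtLeast-mono Q⊆Q′) (AtLeast-mono Q′⊆Q)

module _ {Q : Pred X 0ℓ} where

  AtLeast-≤ : i ≤ j → AtLeast j Q → AtLeast i Q
  AtLeast-≤ i≤j (atLeast f f-inj f-sat) =
    atLeast (f ∘ (λ x → inject≤ x i≤j)) (inject≤-injective i≤j i≤j _ _ ∘ f-inj)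
            (f-sat ∘ (λ x → inject≤ x i≤j))

  AtLeast-zero : AtLeast 0 Q
  AtLeast-zero = atLeast (λ ()) (λ { {()} }) (λ ())

  AtLeast-one : ∀ {x} → Q x → AtLeast 1 Q
  AtLeast-one {x} Qx = atLeast (λ _ → x) (λ { {zero} {zero} _ → refl }) (λ _ → Qx)

  AtLeast-suc⇒∃ : AtLeast (suc j) Q → Σ X Q
  AtLeast-suc⇒∃ (atLeast f _ f-sat) = f zero , f-sat zero

  AtLeast-cons : ∀ {x} → Q x → AtLeast j (Without Q x) → AtLeast (suc j) Q
  AtLeast-cons {j} {x} Qx (atLeast f f-inj f-sat) = atLeast g g-inj g-sat
    where
    g : Fin (suc j) → X
    g zero    = x
    g (suc i) = f i
    g-inj : Injective _≡_ _≡_ g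
    g-inj {zero}  {zero}   _  = refl
    g-inj {zero}  {suc i′} eq = ⊥-elim (proj₂ (f-sat i′) (sym eq))
    g-inj {suc i} {zero}   eq = ⊥-elim (proj₂ (f-sat i) eq)
    g-inj {suc i} {suc i′} eq = cong suc (f-inj eq)
    g-sat : ∀ i → Q (g i)
    g-sat zero    = Qx
    g-sat (suc i) = proj₁ (f-sat i)

  AtLeast-uncons : DecidableEquality X → ∀ x → AtLeast (suc j) Q → AtLeast j (Without Q x)
  AtLeast-uncons _≟_ x (atLeast f f-inj f-sat) with Finₚ.any? (λ i → f i ≟ x)
  ... | yes (i , fi≡x) =
    atLeast (f ∘ punchIn i) (punchIn-injective i _ _ ∘ f-inj)
            (λ i′ → f-sat _ , λ eq → punchInᵢ≢i i i′ (f-inj (trans eq (sym fi≡x))))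
  ... | no x∉f =
    atLeast (f ∘ suc) (suc-injective ∘ f-inj) (λ i′ → f-sat _ , λ eq → x∉f (suc i′ , eq))

  Exactly-byBijection : ∀ {n} (f : Fin n → X) → Injective _≡_ _≡_ f → (∀ i → Q (f i)) →
                        (g : ∀ x → Q x → Fin n) → (∀ x y Qx Qy → g x Qx ≡ g y Qy → x ≡ y) → Exactly n Q
  Exactly-byBijection f f-inj f-sat g g-inj =
    atLeast f f-inj f-sat ,
    λ (atLeast h h-inj h-sat) → <-irrefl refl (injective⇒≤ (h-inj ∘ g-inj _ _ (h-sat _) (h-sat _)))

record Agree {X Y : Set} (k : ℕ) (Q : Pred X 0ℓ) (Q′ : Pred Y 0ℓ) : Set where
  constructor mkAgree
  field agree : ∀ {j} → j ≤ k → AtLeast j Q ⇔ AtLeast j Q′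
open Agree public

Agree-refl : {Q : Pred X 0ℓ} → Agree k Q Q
Agree-refl = mkAgree λ _ → ⇔.refl

module _ {Q : Pred X 0ℓ} {Q′ : Pred Y 0ℓ} where

  Agree-sym : Agree k Q Q′ → Agree k Q′ Q
  Agree-sym Q≈Q′ = mkAgree (⇔.sym ∘ agree Q≈Q′)

  Agree-trans : {Q″ : Pred Z 0ℓ} → Agree k Q Q′ → Agree k Q′ Q″ → Agree k Q Q″
  Agree-trans Q≈Q′ Q′≈Q″ = mkAgree λ j≤k → ⇔.trans (agree Q≈Q′ j≤k) (agree Q′≈Q″ j≤k)

  Agree-≤ : j ≤ k → Agree k Q Q′ → Agree j Q Q′
  Agree-≤ j≤k Q≈Q′ = mkAgree λ i≤j → agree Q≈Q′ (≤-trans i≤j j≤k)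

  Agree-cong : {R : Pred X 0ℓ} {R′ : Pred Y 0ℓ} → Q ≐′ R → Q′ ≐′ R′ → Agree k Q Q′ → Agree k R R′
  Agree-cong Q≐R Q′≐R′ Q≈Q′ =
    mkAgree λ j≤k → ⇔.trans (⇔.sym (AtLeast-cong Q≐R)) (⇔.trans (agree Q≈Q′ j≤k) (AtLeast-cong Q′≐R′))

  Agree-witness : Agree (suc k) Q Q′ → ∀ {x} → Q x → Σ Y Q′
  Agree-witness Q≈Q′ Qx = AtLeast-suc⇒∃ (to (agree Q≈Q′ (s≤s z≤n)) (AtLeast-one Qx))

  Agree-without : DecidableEquality X → DecidableEquality Y → ∀ {x y} → Dec (Q x) → Q x ⇔ Q′ y →
                  Agree (suc k) Q Q′ → Agree k (Without Q x) (Without Q′ y)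
  Agree-without _≟_ _≟′_ {x} {y} (yes Qx) Qx⇔Q′y Q≈Q′ = mkAgree λ j≤k → mk⇔
    (AtLeast-uncons _≟′_ y ∘ to (agree Q≈Q′ (s≤s j≤k)) ∘ AtLeast-cons Qx)
    (AtLeast-uncons _≟_ x ∘ from (agree Q≈Q′ (s≤s j≤k)) ∘ AtLeast-cons (to Qx⇔Q′y Qx))
  Agree-without _ _ (no ¬Qx) Qx⇔Q′y Q≈Q′ =
    Agree-cong (Without-¬ ¬Qx) (Without-¬ (¬Qx ∘ from Qx⇔Q′y)) (Agree-≤ (n≤1+n _) Q≈Q′)

CappedCount : (B : ℕ) → Fin (suc B) → Pred X 0ℓ → Set
CappedCount B v Q = AtLeast (toℕ v) Q × (toℕ v < B → ¬ AtLeast (suc (toℕ v)) Q)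

Exactly⇒CappedCount : ∀ {B v} {Q : Pred X 0ℓ} → Exactly (toℕ v) Q → CappedCount B v Q
Exactly⇒CappedCount (atLeast-v , ¬atLeast-1+v) = atLeast-v , λ _ → ¬atLeast-1+v

module _ {B : ℕ} {Q : Pred X 0ℓ} where

  CappedCount⇔ : ∀ {v} → CappedCount B v Q ⇔
                         ((toℕ v < B → Exactly (toℕ v) Q) × (toℕ v ≡ B → AtLeast (toℕ v) Q))
  CappedCount⇔ {v} = mk⇔ (λ (atLeast-v , atMost-v) → (λ v<B → atLeast-v , atMost-v v<B) , λ _ → atLeast-v) from′
    where
    from′ : (toℕ v < B → Exactly (toℕ v) Q) × (toℕ v ≡ B → AtLeast (toℕ v) Q) → CappedCount B v Q
    from′ (below , atCap) with toℕ v <? B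
    ... | yes v<B = proj₁ (below v<B) , λ _ → proj₂ (below v<B)
    ... | no  v≮B = atCap (≤-antisym (toℕ≤pred[n] v) (≮⇒≥ v≮B)) , λ v<B → ⊥-elim (v≮B v<B)

  CappedCount-unique : ∀ {v w} → Exactly (toℕ v) Q → CappedCount B w Q → w ≡ v
  CappedCount-unique {v} {w} (atLeast-v , ¬atLeast-1+v) (atLeast-w , atMost-w) = toℕ-injective (≤-antisym w≤v v≤w)
    where
    w≤v : toℕ w ≤ toℕ v
    w≤v = ≮⇒≥ λ v<w → ¬atLeast-1+v (AtLeast-≤ v<w atLeast-w)
    v≤w : toℕ v ≤ toℕ w
    v≤w with toℕ w <? B
    ... | yes w<B = ≮⇒≥ λ w<v → atMost-w w<B (AtLeast-≤ w<v atLeast-v)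
    ... | no  w≮B = ≤-trans (toℕ≤pred[n] v) (≮⇒≥ w≮B)

  CappedCount-transfer : ∀ {v} {Q′ : Pred Y 0ℓ} → Agree B Q Q′ → CappedCount B v Q → CappedCount B v Q′
  CappedCount-transfer {v = v} Q≈Q′ (atLeast-v , atMost-v) =
    to (agree Q≈Q′ (toℕ≤pred[n] v)) atLeast-v , λ v<B → atMost-v v<B ∘ from (agree Q≈Q′ v<B)

  CappedCount⇒Agree : ∀ {v} {Q′ : Pred Y 0ℓ} → CappedCount B v Q → CappedCount B v Q′ → Agree B Q Q′
  CappedCount⇒Agree c c′ = mkAgree λ i≤B → mk⇔ (transport c c′ i≤B) (transport c′ c i≤B)
    where
    transport : {Z Z′ : Set} {R : Pred Z 0ℓ} {R′ : Pred Z′ 0ℓ} {v : Fin (suc B)} {i : ℕ} →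
                CappedCount B v R → CappedCount B v R′ → i ≤ B → AtLeast i R → AtLeast i R′
    transport {v = v} {i} (_ , atMost-v) (atLeast-v′ , _) i≤B atLeast-i with i ≤? toℕ v
    ... | yes i≤v = AtLeast-≤ i≤v atLeast-v′
    ... | no  i≰v = ⊥-elim (atMost-v (<-≤-trans (≰⇒> i≰v) i≤B) (AtLeast-≤ (≰⇒> i≰v) atLeast-i))

module _ (em : ExcludedMiddle 0ℓ) (Q : Pred X 0ℓ) where

  exactCount-below : ∀ j → ¬ AtLeast (suc j) Q → Σ (Fin (suc j)) λ v → Exactly (toℕ v) Q
  exactCount-below j ¬atLeast-1+j with em {AtLeast j Q}
  ... | yes atLeast-j = fromℕ j , subst (λ n → Exactly n Q) (sym (toℕ-fromℕ j)) (atLeast-j , ¬atLeast-1+j)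
  exactCount-below zero    _ | no ¬atLeast-0 = ⊥-elim (¬atLeast-0 AtLeast-zero)
  exactCount-below (suc j) _ | no ¬atLeast-1+j with exactCount-below j ¬atLeast-1+j
  ... | v , exactly-v = inject₁ v , subst (λ n → Exactly n Q) (sym (toℕ-inject₁ v)) exactly-v

  cappedCount : ∀ B → Σ (Fin (suc B)) λ v → CappedCount B v Q
  cappedCount B with em {AtLeast B Q}
  ... | yes atLeast-B =
    fromℕ B , subst (λ n → AtLeast n Q) (sym (toℕ-fromℕ B)) atLeast-B ,
    λ B<B → ⊥-elim (<-irrefl (toℕ-fromℕ B) B<B)
  cappedCount zero    | no ¬atLeast-0 = ⊥-elim (¬atLeast-0 AtLeast-zero)
  cappedCount (suc b) | no ¬atLeast-B with exactCount-below b ¬atLeast-B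
  ... | v , exactly-v =
    inject₁ v , Exactly⇒CappedCount (subst (λ n → Exactly n Q) (sym (toℕ-inject₁ v)) exactly-v)

Count : Bowtie → ℕ → Pred X 0ℓ → Set
Count ≥' m Q = AtLeast m Q
Count =' m Q = Exactly m Q

capBowtie : (B : ℕ) → Fin (suc B) → Bowtie
capBowtie B v = bowtieOf (toℕ v <? B)
  where
  bowtieOf : Dec (toℕ v < B) → Bowtie
  bowtieOf (yes _) = ='
  bowtieOf (no  _) = ≥'

CappedCount⇔Count : ∀ {B v} {Q : Pred X 0ℓ} → CappedCount B v Q ⇔ Count (capBowtie B v) (toℕ v) Q
CappedCount⇔Count {B = B} {v} with toℕ v <? B
... | yes v<B = mk⇔ (λ (atLeast-v , atMost-v) → atLeast-v , atMost-v v<B)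
                    (λ (atLeast-v , ¬more) → atLeast-v , λ _ → ¬more)
... | no  v≮B = mk⇔ proj₁ (λ atLeast-v → atLeast-v , λ v<B → ⊥-elim (v≮B v<B))

data Kind (nA : ℕ) : Set where
  process  : PType → Kind nA
  position : Fin nA → Kind nA

process-injective : ∀ {nA θ θ′} → process {nA} θ ≡ process θ′ → θ ≡ θ′
process-injective refl = refl

-- The universe P ⊎ Pos(w), partitioned into the ~-classes, which are indexed by Proc; each
-- class contains exactly one element of process kind, and it carries the type of the class.
record Structure (nA : ℕ) : Set₁ where
  field
    Dom Proc         : Set
    classOf          : Dom → Proc
    kind             : Dom → Kind nA
    typeOf           : Proc → PType
    procElem         : Proc → Dom
    classOf-procElem : ∀ p → classOf (procElem p) ≡ p
    kind-procElem    : ∀ p → kind (procElem p) ≡ process (typeOf p)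
    procElem-unique  : ∀ d θ → kind d ≡ process θ → d ≡ procElem (classOf d)
open Structure public

module _ {nA : ℕ} where

  Holds : ∀ {n} (S : Structure nA) → Formula nA n → (Fin n → Dom S) → Set
  Holds S (typ θ x) ρ = kind S (ρ x) ≡ process θ
  Holds S (lab a x) ρ = kind S (ρ x) ≡ position a
  Holds S (x ≐ y)   ρ = ρ x ≡ ρ y
  Holds S (x ∼ y)   ρ = classOf S (ρ x) ≡ classOf S (ρ y)
  Holds S (¬' φ)    ρ = ¬ Holds S φ ρ
  Holds S (φ ∨' ψ)  ρ = Holds S φ ρ ⊎ Holds S ψ ρ
  Holds S (∃' φ)    ρ = Σ (Dom S) λ d → Holds S φ (d ∷ᵥ ρ)

  rank : ∀ {n} → Formula nA n → ℕ
  rank (typ _ _) = 0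
  rank (lab _ _) = 0
  rank (_ ≐ _)   = 0
  rank (_ ∼ _)   = 0
  rank (¬' φ)    = rank φ
  rank (φ ∨' ψ)  = rank φ ⊔ rank ψ
  rank (∃' φ)    = suc (rank φ)

  module _ (S : Structure nA) where

    Holds-cong : ∀ {n} (φ : Formula nA n) {ρ σ : Fin n → Dom S} → ρ ≗ σ → Holds S φ ρ ⇔ Holds S φ σ
    Holds-cong (typ θ x) ρ≗σ = ≡-⇔ (process θ) (cong (kind S) (ρ≗σ x))
    Holds-cong (lab a x) ρ≗σ = ≡-⇔ (position a) (cong (kind S) (ρ≗σ x))
    Holds-cong (x ≐ y)   ρ≗σ = ≡-⇔₂ (ρ≗σ x) (ρ≗σ y)
    Holds-cong (x ∼ y)   ρ≗σ = ≡-⇔₂ (cong (classOf S) (ρ≗σ x)) (cong (classOf S) (ρ≗σ y))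
    Holds-cong (¬' φ)    ρ≗σ = ¬-cong-⇔ (Holds-cong φ ρ≗σ)
    Holds-cong (φ ∨' ψ)  ρ≗σ = Holds-cong φ ρ≗σ ⊎-⇔ Holds-cong ψ ρ≗σ
    Holds-cong (∃' φ)    ρ≗σ = ∃-cong λ d → Holds-cong φ λ { zero → refl ; (suc x) → ρ≗σ x }

    Holds-rename : ∀ {n k} (r : Fin n → Fin k) (φ : Formula nA n) {ρ : Fin k → Dom S} {σ : Fin n → Dom S} →
                   ρ ∘ r ≗ σ → Holds S (rename r φ) ρ ⇔ Holds S φ σ
    Holds-rename r (typ θ x) ρ∘r≗σ = Holds-cong (typ θ x) ρ∘r≗σ
    Holds-rename r (lab a x) ρ∘r≗σ = Holds-cong (lab a x) ρ∘r≗σ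
    Holds-rename r (x ≐ y)   ρ∘r≗σ = Holds-cong (x ≐ y) ρ∘r≗σ
    Holds-rename r (x ∼ y)   ρ∘r≗σ = Holds-cong (x ∼ y) ρ∘r≗σ
    Holds-rename r (¬' φ)    ρ∘r≗σ = ¬-cong-⇔ (Holds-rename r φ ρ∘r≗σ)
    Holds-rename r (φ ∨' ψ)  ρ∘r≗σ = Holds-rename r φ ρ∘r≗σ ⊎-⇔ Holds-rename r ψ ρ∘r≗σ
    Holds-rename r (∃' φ)    ρ∘r≗σ = ∃-cong λ d → Holds-rename _ φ λ { zero → refl ; (suc x) → ρ∘r≗σ x }

    typeOf-classOf : ∀ {d θ} → kind S d ≡ process θ → typeOf S (classOf S d) ≡ θ
    typeOf-classOf {d} {θ} kd = process-injective (begin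
      process (typeOf S (classOf S d))  ≡⟨ kind-procElem S _ ⟨
      kind S (procElem S (classOf S d)) ≡⟨ cong (kind S) (procElem-unique S d θ kd) ⟨
      kind S d                          ≡⟨ kd ⟩
      process θ                         ∎)
      where open ≡-Reasoning

    kind≡kind-procElem : (S′ : Structure nA) {d : Dom S} {c′ : Proc S′} {θ : PType} → kind S d ≡ process θ →
                         typeOf S (classOf S d) ≡ typeOf S′ c′ → kind S d ≡ kind S′ (procElem S′ c′)
    kind≡kind-procElem S′ {d} {c′} {θ} kd same-type = begin
      kind S d                         ≡⟨ kd ⟩
      process θ                        ≡⟨ cong process (typeOf-classOf kd) ⟨
      process (typeOf S (classOf S d)) ≡⟨ cong process same-type ⟩
      process (typeOf S′ c′)           ≡⟨ kind-procElem S′ c′ ⟨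
      kind S′ (procElem S′ c′)         ∎
      where open ≡-Reasoning

    procElem-injective : Injective _≡_ _≡_ (procElem S)
    procElem-injective {p} {p′} eq =
      trans (sym (classOf-procElem S p)) (trans (cong (classOf S) eq) (classOf-procElem S p′))

    classOf-injective-on-processes : ∀ {d d′ θ θ′} → kind S d ≡ process θ → kind S d′ ≡ process θ′ →
                                     classOf S d ≡ classOf S d′ → d ≡ d′
    classOf-injective-on-processes {d} {d′} kd kd′ eq =
      trans (procElem-unique S d _ kd) (trans (cong (procElem S) eq) (sym (procElem-unique S d′ _ kd′)))

    AtLeast-processes : (θ : PType) (R : Pred (Proc S) 0ℓ) {j : ℕ} →
                        AtLeast j (λ d → kind S d ≡ process θ × R (classOf S d)) ⇔
                        AtLeast j (λ p → typeOf S p ≡ θ × R p)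
    AtLeast-processes θ R = mk⇔
      (λ (atLeast f f-inj f-sat) → atLeast (classOf S ∘ f)
        (f-inj ∘ classOf-injective-on-processes (proj₁ (f-sat _)) (proj₁ (f-sat _)))
        (λ i → typeOf-classOf (proj₁ (f-sat i)) , proj₂ (f-sat i)))
      (λ (atLeast g g-inj g-sat) → atLeast (procElem S ∘ g)
        (g-inj ∘ procElem-injective)
        (λ i → trans (kind-procElem S (g i)) (cong process (proj₁ (g-sat i))) ,
               subst R (sym (classOf-procElem S (g i))) (proj₂ (g-sat i))))

module _ {nA np : ℕ} {side : Fin nA → Side} {ptype : Fin np → PType} (w : Execution side ptype) where
  open Semantics w

  procOf : Elem → Fin np
  procOf (inj₁ p) = p
  procOf (inj₂ i) = proc w i

  kindOf : Elem → Kind nA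
  kindOf (inj₁ p) = process (ptype p)
  kindOf (inj₂ i) = position (act w i)

  executionStructure : Structure nA
  executionStructure = record
    { Dom = Elem ; Proc = Fin np ; classOf = procOf ; kind = kindOf ; typeOf = ptype ; procElem = inj₁
    ; classOf-procElem = λ _ → refl
    ; kind-procElem    = λ _ → refl
    ; procElem-unique  = λ { (inj₁ _) _ _ → refl ; (inj₂ _) _ () }
    }

  ≈⇒procOf≡ : ∀ {x y} → x ≈ y → procOf x ≡ procOf y
  ≈⇒procOf≡ (base-pi eq)      = sym eq
  ≈⇒procOf≡ (base-ij eq)      = eq
  ≈⇒procOf≡ ≈-refl            = refl
  ≈⇒procOf≡ (≈-sym x≈y)       = sym (≈⇒procOf≡ x≈y)
  ≈⇒procOf≡ (≈-trans x≈y y≈z) = trans (≈⇒procOf≡ x≈y) (≈⇒procOf≡ y≈z)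

  procOf≡⇒≈ : ∀ x y → procOf x ≡ procOf y → x ≈ y
  procOf≡⇒≈ (inj₁ p) (inj₁ _) refl = ≈-refl
  procOf≡⇒≈ (inj₁ p) (inj₂ i) eq   = base-pi (sym eq)
  procOf≡⇒≈ (inj₂ i) (inj₁ p) eq   = ≈-sym (base-pi eq)
  procOf≡⇒≈ (inj₂ i) (inj₂ j) eq   = base-ij eq

  Sat⇔Holds : ∀ {n} (φ : Formula nA n) (ρ : Fin n → Elem) → Sat φ ρ ⇔ Holds executionStructure φ ρ
  Sat⇔Holds (typ θ x) ρ with ρ x
  ... | inj₁ p = mk⇔ (cong process) process-injective
  ... | inj₂ i = mk⇔ (λ ()) (λ ())
  Sat⇔Holds (lab a x) ρ with ρ x
  ... | inj₁ p = mk⇔ (λ ()) (λ ())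
  ... | inj₂ i = mk⇔ (cong position) (λ { refl → refl })
  Sat⇔Holds (x ≐ y)   ρ = ⇔.refl
  Sat⇔Holds (x ∼ y)   ρ = mk⇔ ≈⇒procOf≡ (procOf≡⇒≈ _ _)
  Sat⇔Holds (¬' φ)    ρ = ¬-cong-⇔ (Sat⇔Holds φ ρ)
  Sat⇔Holds (φ ∨' ψ)  ρ = Sat⇔Holds φ ρ ⊎-⇔ Sat⇔Holds ψ ρ
  Sat⇔Holds (∃' φ)    ρ = ∃-cong λ d →
    ⇔.trans (Sat⇔Holds φ _) (Holds-cong executionStructure φ λ { zero → refl ; (suc x) → refl })

-- The Ehrenfeucht–Fraïssé game

SameKernel : {A A′ B B′ : Set} (f : A → B) (f′ : A′ → B′) {n : ℕ} → (Fin n → A) → (Fin n → A′) → Set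
SameKernel f f′ σ σ′ = ∀ x y → (f (σ x) ≡ f (σ y)) ⇔ (f′ (σ′ x) ≡ f′ (σ′ y))

SameKernel-∷ : {A A′ B B′ : Set} (f : A → B) (f′ : A′ → B′) {n : ℕ} {σ : Fin n → A} {σ′ : Fin n → A′}
               {c : A} {c′ : A′} → (∀ x → (f c ≡ f (σ x)) ⇔ (f′ c′ ≡ f′ (σ′ x))) →
               SameKernel f f′ σ σ′ → SameKernel f f′ (c ∷ᵥ σ) (c′ ∷ᵥ σ′)
SameKernel-∷ f f′ new old zero    zero    = mk⇔ (λ _ → refl) (λ _ → refl)
SameKernel-∷ f f′ new old zero    (suc y) = new y
SameKernel-∷ f f′ new old (suc x) zero    = mk⇔ (sym ∘ to (new x) ∘ sym) (sym ∘ from (new x) ∘ sym)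
SameKernel-∷ f f′ new old (suc x) (suc y) = old x y

∁-image-∷ : {A B : Set} (f : A → B) {n : ℕ} {σ : Fin n → A} {c : A} {Q : Pred B 0ℓ} →
            Without (Q ∩ ∁ (λ b → Σ (Fin n) λ x → b ≡ f (σ x))) (f c) ≐′
            Q ∩ ∁ (λ b → Σ (Fin (suc n)) λ x → b ≡ f ((c ∷ᵥ σ) x))
∁-image-∷ f = (λ ((Qb , b∉) , b≢fc) → Qb , λ { (zero , eq) → b≢fc eq ; (suc x , eq) → b∉ (x , eq) })
            , (λ (Qb , b∉) → (Qb , λ (x , eq) → b∉ (suc x , eq)) , λ eq → b∉ (zero , eq))

module _ {nA : ℕ} where

  Pebbled : (S : Structure nA) {n : ℕ} → (Fin n → Dom S) → Pred (Dom S) 0ℓ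
  Pebbled S ρ d = Σ _ λ x → d ≡ ρ x

  Touched : (S : Structure nA) {n : ℕ} → (Fin n → Dom S) → Pred (Proc S) 0ℓ
  Touched S ρ p = Σ _ λ x → p ≡ classOf S (ρ x)

  Event : (S : Structure nA) → Proc S → Fin nA → Pred (Dom S) 0ℓ
  Event S p a d = kind S d ≡ position a × classOf S d ≡ p

  FreeEvent : (S : Structure nA) {n : ℕ} → (Fin n → Dom S) → Proc S → Fin nA → Pred (Dom S) 0ℓ
  FreeEvent S ρ p a = Event S p a ∩ ∁ (Pebbled S ρ)

  FreeEvent-untouched : (S : Structure nA) {n : ℕ} {ρ : Fin n → Dom S} {p : Proc S} {a : Fin nA} →
                        ¬ Touched S ρ p → Event S p a ≐′ FreeEvent S ρ p a
  FreeEvent-untouched S ¬touched =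
    (λ (kd , cd) → (kd , cd) , λ (x , eq) → ¬touched (x , trans (sym cd) (cong (classOf S) eq))) , proj₁

  record Similar (K : ℕ) (S : Structure nA) (p : Proc S) (S′ : Structure nA) (p′ : Proc S′) : Set where
    constructor similar
    field
      same-type   : typeOf S p ≡ typeOf S′ p′
      same-events : ∀ a → Agree K (Event S p a) (Event S′ p′ a)
  open Similar public

  module _ {K : ℕ} where

    Similar-refl : ∀ {S p} → Similar K S p S p
    Similar-refl = similar refl λ _ → Agree-refl

    Similar-sym : ∀ {S p S′ p′} → Similar K S p S′ p′ → Similar K S′ p′ S p
    Similar-sym (similar θ≡θ′ agree) = similar (sym θ≡θ′) (Agree-sym ∘ agree)

    Similar-trans : ∀ {S p S′ p′ S″ p″} →
                    Similar K S p S′ p′ → Similar K S′ p′ S″ p″ → Similar K S p S″ p″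
    Similar-trans (similar θ≡θ′ agree) (similar θ′≡θ″ agree′) =
      similar (trans θ≡θ′ θ′≡θ″) λ a → Agree-trans (agree a) (agree′ a)

  FreeSimilar : ℕ → (S : Structure nA) {n : ℕ} → (Fin n → Dom S) → (S₀ : Structure nA) → Proc S₀ →
                Pred (Proc S) 0ℓ
  FreeSimilar K S ρ S₀ r = (λ p → Similar K S p S₀ r) ∩ ∁ (Touched S ρ)

  HasType : (B : ℕ) (S : Structure nA) → PType → (Fin nA → Fin (suc B)) → Pred (Proc S) 0ℓ
  HasType B S θ ℓ p = typeOf S p ≡ θ × ∀ a → CappedCount B (ℓ a) (Event S p a)

  Similar⇔HasType : ∀ {K S S₀ r ℓ} → (∀ a → CappedCount K (ℓ a) (Event S₀ r a)) →
                    ∀ p → Similar K S p S₀ r ⇔ HasType K S (typeOf S₀ r) ℓ p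
  Similar⇔HasType r-counts p = mk⇔
    (λ (similar θ≡θ₀ agree) → θ≡θ₀ , λ a → CappedCount-transfer (Agree-sym (agree a)) (r-counts a))
    (λ (θ≡θ₀ , p-counts) → similar θ≡θ₀ λ a → CappedCount⇒Agree (p-counts a) (r-counts a))

  -- A position with k rounds left. Untouched processes are compared, up to threshold k, through
  -- the number of those K-similar to a reference process r, for all r of all structures.
  record Invariant (S S′ : Structure nA) (K k : ℕ) {n : ℕ} (ρ : Fin n → Dom S) (ρ′ : Fin n → Dom S′) : Set₁ where
    field
      k≤K          : k ≤ K
      same-pebbles : SameKernel id id ρ ρ′
      same-classes : SameKernel (classOf S) (classOf S′) ρ ρ′
      same-kind    : ∀ x → kind S (ρ x) ≡ kind S′ (ρ′ x)
      same-type    : ∀ x → typeOf S (classOf S (ρ x)) ≡ typeOf S′ (classOf S′ (ρ′ x))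
      free-events  : ∀ x a → Agree k (FreeEvent S ρ (classOf S (ρ x)) a) (FreeEvent S′ ρ′ (classOf S′ (ρ′ x)) a)
      free-similar : ∀ S₀ r → Agree k (FreeSimilar K S ρ S₀ r) (FreeSimilar K S′ ρ′ S₀ r)
  open Invariant public

  Invariant-sym : ∀ {S S′ K k n} {ρ : Fin n → Dom S} {ρ′ : Fin n → Dom S′} →
                  Invariant S S′ K k ρ ρ′ → Invariant S′ S K k ρ′ ρ
  Invariant-sym I = record
    { k≤K          = k≤K I
    ; same-pebbles = λ x y → ⇔.sym (same-pebbles I x y)
    ; same-classes = λ x y → ⇔.sym (same-classes I x y)
    ; same-kind    = sym ∘ same-kind I
    ; same-type    = sym ∘ same-type I
    ; free-events  = λ x a → Agree-sym (free-events I x a)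
    ; free-similar = λ S₀ r → Agree-sym (free-similar I S₀ r)
    }

  record Reply (S S′ : Structure nA) (K k : ℕ) {n : ℕ} (ρ : Fin n → Dom S) (ρ′ : Fin n → Dom S′)
               (d : Dom S) (d′ : Dom S′) : Set where
    field
      new-pebble  : ∀ x → (d ≡ ρ x) ⇔ (d′ ≡ ρ′ x)
      new-class   : ∀ x → (classOf S d ≡ classOf S (ρ x)) ⇔ (classOf S′ d′ ≡ classOf S′ (ρ′ x))
      new-kind    : kind S d ≡ kind S′ d′
      new-type    : typeOf S (classOf S d) ≡ typeOf S′ (classOf S′ d′)
      new-events  : ∀ a → Agree (suc k) (FreeEvent S ρ (classOf S d) a) (FreeEvent S′ ρ′ (classOf S′ d′) a)
      new-similar : ¬ Touched S ρ (classOf S d) → Similar K S (classOf S d) S′ (classOf S′ d′)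
  open Reply public

  module _ (em : ExcludedMiddle 0ℓ) where

    private
      _≟_ : DecidableEquality X
      _ ≟ _ = em

    module _ {S S′ : Structure nA} {K k n : ℕ} {ρ : Fin n → Dom S} {ρ′ : Fin n → Dom S′} {d : Dom S} {d′ : Dom S′}
             (I : Invariant S S′ K (suc k) ρ ρ′) (R : Reply S S′ K k ρ ρ′ d d′) where

      Invariant-∷ : Invariant S S′ K k (d ∷ᵥ ρ) (d′ ∷ᵥ ρ′)
      Invariant-∷ = record
        { k≤K          = ≤-trans (n≤1+n k) (k≤K I)
        ; same-pebbles = SameKernel-∷ id id (new-pebble R) (same-pebbles I)
        ; same-classes = classes
        ; same-kind    = λ { zero → new-kind R ; (suc x) → same-kind I x }
        ; same-type    = λ { zero → new-type R ; (suc x) → same-type I x }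
        ; free-events  = λ z a → Agree-cong (∁-image-∷ id) (∁-image-∷ id)
                                   (Agree-without _≟_ _≟_ em (free-event-d z a) (old-events z a))
        ; free-similar = λ S₀ r → Agree-cong (∁-image-∷ (classOf S)) (∁-image-∷ (classOf S′))
                                    (Agree-without _≟_ _≟_ em (free-similar-d S₀ r) (free-similar I S₀ r))
        }
        where
        classes : SameKernel (classOf S) (classOf S′) (d ∷ᵥ ρ) (d′ ∷ᵥ ρ′)
        classes = SameKernel-∷ (classOf S) (classOf S′) (new-class R) (same-classes I)
        touched : Touched S ρ (classOf S d) ⇔ Touched S′ ρ′ (classOf S′ d′)
        touched = ∃-cong (new-class R)
        old-events : ∀ z a → Agree (suc k) (FreeEvent S ρ (classOf S ((d ∷ᵥ ρ) z)) a)
                                           (FreeEvent S′ ρ′ (classOf S′ ((d′ ∷ᵥ ρ′) z)) a)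
        old-events zero    = new-events R
        old-events (suc x) = free-events I x
        free-event-d : ∀ z a → FreeEvent S ρ (classOf S ((d ∷ᵥ ρ) z)) a d ⇔
                               FreeEvent S′ ρ′ (classOf S′ ((d′ ∷ᵥ ρ′) z)) a d′
        free-event-d z a = (≡-⇔ (position a) (new-kind R) ×-⇔ classes zero z) ×-⇔ ¬-cong-⇔ (∃-cong (new-pebble R))
        free-similar-d : ∀ S₀ r → FreeSimilar K S ρ S₀ r (classOf S d) ⇔
                                  FreeSimilar K S′ ρ′ S₀ r (classOf S′ d′)
        free-similar-d S₀ r = mk⇔
          (λ (sim , ¬t) → Similar-trans (Similar-sym (new-similar R ¬t)) sim , ¬t ∘ from touched)
          (λ (sim , ¬t′) → Similar-trans (new-similar R (¬t′ ∘ to touched)) sim , ¬t′ ∘ to touched)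

    module _ {S S′ : Structure nA} {K k n : ℕ} {ρ : Fin n → Dom S} {ρ′ : Fin n → Dom S′}
             (I : Invariant S S′ K (suc k) ρ ρ′) where

      reply-pebbled : ∀ y → Reply S S′ K k ρ ρ′ (ρ y) (ρ′ y)
      reply-pebbled y = record
        { new-pebble  = same-pebbles I y
        ; new-class   = same-classes I y
        ; new-kind    = same-kind I y
        ; new-type    = same-type I y
        ; new-events  = free-events I y
        ; new-similar = λ ¬t → ⊥-elim (¬t (y , refl))
        }

      reply-touched : ∀ {d d′} x → classOf S d ≡ classOf S (ρ x) → classOf S′ d′ ≡ classOf S′ (ρ′ x) →
                      ¬ Pebbled S ρ d → ¬ Pebbled S′ ρ′ d′ → kind S d ≡ kind S′ d′ →
                      Reply S S′ K k ρ ρ′ d d′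
      reply-touched {d} {d′} x d~x d′~x′ d-free d′-free kd≡kd′ = record
        { new-pebble  = λ z → mk⇔ (⊥-elim ∘ d-free ∘ (z ,_)) (⊥-elim ∘ d′-free ∘ (z ,_))
        ; new-class   = λ z → move (λ p p′ → (p ≡ classOf S (ρ z)) ⇔ (p′ ≡ classOf S′ (ρ′ z)))
                                   (same-classes I x z)
        ; new-kind    = kd≡kd′
        ; new-type    = move (λ p p′ → typeOf S p ≡ typeOf S′ p′) (same-type I x)
        ; new-events  = λ a → move (λ p p′ → Agree (suc k) (FreeEvent S ρ p a) (FreeEvent S′ ρ′ p′ a))
                                   (free-events I x a)
        ; new-similar = λ ¬t → ⊥-elim (¬t (x , d~x))
        }
        where
        move : (P : Proc S → Proc S′ → Set) →
               P (classOf S (ρ x)) (classOf S′ (ρ′ x)) → P (classOf S d) (classOf S′ d′)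
        move P = subst₂ P (sym d~x) (sym d′~x′)

      reply-untouched : ∀ {d d′ p′} → classOf S′ d′ ≡ p′ → ¬ Touched S ρ (classOf S d) → ¬ Touched S′ ρ′ p′ →
                        Similar K S (classOf S d) S′ p′ → kind S d ≡ kind S′ d′ → Reply S S′ K k ρ ρ′ d d′
      reply-untouched refl ¬t ¬t′ sim kd≡kd′ = record
        { new-pebble  = λ z → mk⇔ (λ eq → ⊥-elim (¬t (z , cong (classOf S) eq)))
                                  (λ eq → ⊥-elim (¬t′ (z , cong (classOf S′) eq)))
        ; new-class   = λ z → mk⇔ (⊥-elim ∘ ¬t ∘ (z ,_)) (⊥-elim ∘ ¬t′ ∘ (z ,_))
        ; new-kind    = kd≡kd′
        ; new-type    = same-type sim
        ; new-events  = λ a → Agree-cong (FreeEvent-untouched S ¬t) (FreeEvent-untouched S′ ¬t′)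
                                         (Agree-≤ (k≤K I) (same-events sim a))
        ; new-similar = λ _ → sim
        }

      reply-in-touched-class : ∀ {d} x → classOf S d ≡ classOf S (ρ x) → ¬ Pebbled S ρ d →
                               Σ (Dom S′) (Reply S S′ K k ρ ρ′ d)
      reply-in-touched-class {d} x d~x d-free with kind S d in kd
      ... | process θ = procElem S′ c′ ,
        reply-touched x d~x (classOf-procElem S′ c′) d-free d′-free
                      (kind≡kind-procElem S S′ kd (trans (cong (typeOf S) d~x) (same-type I x)))
        where
        c′ = classOf S′ (ρ′ x)
        d′-free : ¬ Pebbled S′ ρ′ (procElem S′ c′)
        d′-free (z , eq) = d-free (z , classOf-injective-on-processes S kd (trans (same-kind I z) kz′) d~z)
          where
          kz′ : kind S′ (ρ′ z) ≡ process (typeOf S′ c′)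
          kz′ = trans (cong (kind S′) (sym eq)) (kind-procElem S′ c′)
          d~z : classOf S d ≡ classOf S (ρ z)
          d~z = trans d~x (from (same-classes I x z) (trans (sym (classOf-procElem S′ c′)) (cong (classOf S′) eq)))
      ... | position a with Agree-witness (free-events I x a) ((kd , d~x) , d-free)
      ...   | d′ , ((kd′ , d′~x′) , d′-free) =
        d′ , reply-touched x d~x d′~x′ d-free d′-free (trans kd (sym kd′))

      reply-in-similar-class : ∀ {d p′} → ¬ Touched S ρ (classOf S d) → ¬ Touched S′ ρ′ p′ →
                               Similar K S (classOf S d) S′ p′ → Σ (Dom S′) (Reply S S′ K k ρ ρ′ d)
      reply-in-similar-class {d} {p′} ¬t ¬t′ sim with kind S d in kd
      ... | process θ =
        procElem S′ p′ ,
        reply-untouched (classOf-procElem S′ p′) ¬t ¬t′ sim (kind≡kind-procElem S S′ kd (same-type sim))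
      ... | position a with Agree-witness (Agree-≤ (≤-trans (s≤s z≤n) (k≤K I)) (same-events sim a)) (kd , refl)
      ...   | d′ , (kd′ , d′∈p′) = d′ , reply-untouched d′∈p′ ¬t ¬t′ sim (trans kd (sym kd′))

      reply : ∀ d → Σ (Dom S′) (Reply S S′ K k ρ ρ′ d)
      reply d with em {Pebbled S ρ d}
      ... | yes (y , refl) = ρ′ y , reply-pebbled y
      ... | no d-free with em {Touched S ρ (classOf S d)}
      ...   | yes (x , d~x) = reply-in-touched-class x d~x d-free
      ...   | no ¬t with Agree-witness (free-similar I S (classOf S d)) (Similar-refl , ¬t)
      ...     | p′ , (sim , ¬t′) = reply-in-similar-class ¬t ¬t′ (Similar-sym sim)

    Invariant⇒Holds⇔ : ∀ {S S′ K k n} (φ : Formula nA n) {ρ : Fin n → Dom S} {ρ′ : Fin n → Dom S′} →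
                       Invariant S S′ K k ρ ρ′ → rank φ ≤ k → Holds S φ ρ ⇔ Holds S′ φ ρ′
    Invariant⇒Holds⇔ (typ θ x) I _ = ≡-⇔ _ (same-kind I x)
    Invariant⇒Holds⇔ (lab a x) I _ = ≡-⇔ _ (same-kind I x)
    Invariant⇒Holds⇔ (x ≐ y)   I _ = same-pebbles I x y
    Invariant⇒Holds⇔ (x ∼ y)   I _ = same-classes I x y
    Invariant⇒Holds⇔ (¬' φ)    I r = ¬-cong-⇔ (Invariant⇒Holds⇔ φ I r)
    Invariant⇒Holds⇔ (φ ∨' ψ)  I r =
      Invariant⇒Holds⇔ φ I (m⊔n≤o⇒m≤o (rank φ) (rank ψ) r) ⊎-⇔
      Invariant⇒Holds⇔ ψ I (m⊔n≤o⇒n≤o (rank φ) (rank ψ) r)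
    Invariant⇒Holds⇔ {K = K} {suc k} {n} (∃' φ) I (s≤s r) = mk⇔ (forth I) (forth (Invariant-sym I))
      where
      forth : ∀ {T T′} {σ : Fin n → Dom T} {σ′ : Fin n → Dom T′} → Invariant T T′ K (suc k) σ σ′ →
              Holds T (∃' φ) σ → Holds T′ (∃' φ) σ′
      forth J (d , h) = let d′ , R = reply J d in d′ , to (Invariant⇒Holds⇔ φ (Invariant-∷ J R) r) h

    Invariant-[] : ∀ {S S′ K} {ρ : Fin 0 → Dom S} {ρ′ : Fin 0 → Dom S′} →
                   (∀ θ (ℓ : Vec (Fin (suc K)) nA) →
                      Agree K (HasType K S θ (lookup ℓ)) (HasType K S′ θ (lookup ℓ))) →
                   Invariant S S′ K K ρ ρ′
    Invariant-[] {S} {S′} {K} same-types = record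
      { k≤K          = ≤-refl
      ; same-pebbles = λ ()
      ; same-classes = λ ()
      ; same-kind    = λ ()
      ; same-type    = λ ()
      ; free-events  = λ ()
      ; free-similar = λ S₀ r → Agree-cong (HasType≐FreeSimilar S S₀ r) (HasType≐FreeSimilar S′ S₀ r)
                                            (same-types (typeOf S₀ r) (profile S₀ r))
      }
      where
      profile : (S₀ : Structure nA) → Proc S₀ → Vec (Fin (suc K)) nA
      profile S₀ r = tabulate λ a → proj₁ (cappedCount em (Event S₀ r a) K)
      profile-counts : ∀ S₀ r a → CappedCount K (lookup (profile S₀ r) a) (Event S₀ r a)
      profile-counts S₀ r a = subst (λ v → CappedCount K v (Event S₀ r a)) (sym (Vecₚ.lookup∘tabulate _ a))
                                    (proj₂ (cappedCount em (Event S₀ r a) K))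
      HasType≐FreeSimilar : (T S₀ : Structure nA) {σ : Fin 0 → Dom T} (r : Proc S₀) →
                            HasType K T (typeOf S₀ r) (lookup (profile S₀ r)) ≐′ FreeSimilar K T σ S₀ r
      HasType≐FreeSimilar T S₀ r = (λ {p} h → from (Similar⇔HasType (profile-counts S₀ r) p) h , λ ())
                                 , (λ {p} (sim , _) → to (Similar⇔HasType (profile-counts S₀ r) p) sim)

module Connectives (em : ExcludedMiddle 0ℓ) {nA : ℕ} (S : Structure nA) where

  true'-holds : ∀ {n} (ρ : Fin n → Dom S) → Holds S true' ρ
  true'-holds ρ (d , d≢d) = d≢d refl

  ∧'-⇔ : ∀ {n} (φ ψ : Formula nA n) {ρ : Fin n → Dom S} → Holds S (φ ∧' ψ) ρ ⇔ (Holds S φ ρ × Holds S ψ ρ)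
  ∧'-⇔ φ ψ = mk⇔ (λ h → em⇒dne em (h ∘ inj₁) , em⇒dne em (h ∘ inj₂))
                 (λ (hφ , hψ) → [ (λ ¬hφ → ¬hφ hφ) , (λ ¬hψ → ¬hψ hψ) ])

  ⋀-⇔ : ∀ {n} (L : List (Formula nA n)) {ρ : Fin n → Dom S} → Holds S (⋀ L) ρ ⇔ All (λ ψ → Holds S ψ ρ) L
  ⋀-⇔ []          {ρ} = mk⇔ (λ _ → []) (λ _ → true'-holds ρ)
  ⋀-⇔ (φ ∷ [])        = mk⇔ (_∷ []) All.head
  ⋀-⇔ (φ ∷ ψ ∷ L)     =
    ⇔.trans (∧'-⇔ φ (⋀ (ψ ∷ L))) (⇔.trans (⇔.refl ×-⇔ ⋀-⇔ (ψ ∷ L)) (mk⇔ (uncurry _∷_) All.uncons))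

  ⋁-⇔ : ∀ {n} (L : List (Formula nA n)) {ρ : Fin n → Dom S} → Holds S (⋁ L) ρ ⇔ Any (λ ψ → Holds S ψ ρ) L
  ⋁-⇔ []          {ρ} = mk⇔ (λ h → ⊥-elim (h (true'-holds ρ))) (λ ())
  ⋁-⇔ (φ ∷ [])        = mk⇔ here (λ { (here h) → h ; (there ()) })
  ⋁-⇔ (φ ∷ ψ ∷ L)     = ⇔.trans (⇔.refl ⊎-⇔ ⋁-⇔ (ψ ∷ L)) (↔⇒⇔ (Anyₚ.∷↔ _))

  ∃ⁿ-⇔ : ∀ m {n} (φ : Formula nA (m + n)) {ρ : Fin n → Dom S} →
         Holds S (∃ⁿ m φ) ρ ⇔ Σ (Fin m → Dom S) λ τ → Holds S φ (τ ++ ρ)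
  ∃ⁿ-⇔ zero    φ     = mk⇔ ([]ᵥ ,_) proj₂
  ∃ⁿ-⇔ (suc m) φ {ρ} = ⇔.trans (∃ⁿ-⇔ m (∃' φ)) (mk⇔
    (λ (τ , d , h) → d ∷ᵥ τ , from (Holds-cong S φ (++-head-tail (d ∷ᵥ τ) ρ)) h)
    (λ (τ , h) → τ ∘ suc , τ zero , to (Holds-cong S φ (++-head-tail τ ρ)) h))

  ∃≥-⇔ : ∀ m {n} (φ : Formula nA (suc n)) {ρ : Fin n → Dom S} →
         Holds S (∃≥ m φ) ρ ⇔ AtLeast m (λ d → Holds S φ (d ∷ᵥ ρ))
  ∃≥-⇔ zero          φ {ρ} = mk⇔ (λ _ → AtLeast-zero) (λ _ → true'-holds ρ)
  ∃≥-⇔ m@(suc _) {n} φ {ρ} =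
    ⇔.trans (∃ⁿ-⇔ m _)
   (⇔.trans (∃-cong λ τ → ⇔.trans (∧'-⇔ _ _)
                                   (distinct-⇔ τ ×-⇔ members-⇔ _ (λ _ → refl) (λ _ _ → refl) τ))
            (mk⇔ (λ (τ , τ-inj , τ-sat) → atLeast τ τ-inj τ-sat)
                 (λ (atLeast τ τ-inj τ-sat) → τ , τ-inj , τ-sat)))
    where
    unequal : Fin m → Fin m → List (Formula nA (m + n))
    unequal i j = when {nA} (toℕ i <ᵇ toℕ j) (¬' ((i ↑ˡ n) ≐ (j ↑ˡ n)))
    distinct-⇔ : ∀ τ → Holds S (⋀ (concatMap (λ i → concatMap (unequal i) (allFin m)) (allFin m))) (τ ++ ρ) ⇔
                       Injective _≡_ _≡_ τ
    distinct-⇔ τ = begin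
      Holds S (⋀ (concatMap (λ i → concatMap (unequal i) (allFin m)) (allFin m))) (τ ++ ρ)
        ≈⟨ ⇔.trans (⋀-⇔ _) (All-concatMap-allFin _) ⟩
      (∀ i → All (λ ψ → Holds S ψ (τ ++ ρ)) (concatMap (unequal i) (allFin m)))
        ≈⟨ ∀-cong (λ i → ⇔.trans (All-concatMap-allFin _) (∀-cong λ j → All-when {nA = nA} _)) ⟩
      (∀ i j → T (toℕ i <ᵇ toℕ j) → (τ ++ ρ) (i ↑ˡ n) ≢ (τ ++ ρ) (j ↑ˡ n))
        ≈⟨ ∀-cong (λ i → ∀-cong λ j → →-cong-⇔ (mk⇔ (<ᵇ⇒< _ _) <⇒<ᵇ)
                                                (¬-cong-⇔ (≡-⇔₂ (lookup-++ˡ τ ρ i) (lookup-++ˡ τ ρ j)))) ⟩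
      (∀ i j → toℕ i < toℕ j → τ i ≢ τ j)
        ≈⟨ <-distinct⇔Injective τ ⟩
      Injective _≡_ _≡_ τ ∎
      where open ⇔-Reasoning
    members-⇔ : (g : Fin m → Fin (suc n) → Fin (m + n)) →
                (∀ i → g i zero ≡ i ↑ˡ n) → (∀ i x → g i (suc x) ≡ m ↑ʳ x) →
                ∀ τ → Holds S (⋀ (map (λ i → rename (g i) φ) (allFin m))) (τ ++ ρ) ⇔
                      (∀ i → Holds S φ (τ i ∷ᵥ ρ))
    members-⇔ g g-zero g-suc τ =
      ⇔.trans (⋀-⇔ _) (⇔.trans (All-map-allFin _) (∀-cong λ i → Holds-rename S (g i) φ λ
      { zero    → trans (cong (τ ++ ρ) (g-zero i)) (lookup-++ˡ τ ρ i)
      ; (suc x) → trans (cong (τ ++ ρ) (g-suc i x)) (lookup-++ʳ τ ρ x) }))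

  ∃=-⇔ : ∀ m {n} (φ : Formula nA (suc n)) {ρ : Fin n → Dom S} →
         Holds S (∃= m φ) ρ ⇔ Exactly m (λ d → Holds S φ (d ∷ᵥ ρ))
  ∃=-⇔ m φ = ⇔.trans (∧'-⇔ _ _) (∃≥-⇔ m φ ×-⇔ ¬-cong-⇔ (∃≥-⇔ (suc m) φ))

  ψ-⇔ : ∀ B (ℓ : Fin nA → Fin (suc B)) {ρ : Fin 1 → Dom S} →
        Holds S (ψ B ℓ) ρ ⇔ (∀ a → CappedCount B (ℓ a) (Event S (classOf S (ρ zero)) a))
  ψ-⇔ B ℓ {ρ} = begin
    Holds S (ψ B ℓ) ρ
      ≈⟨ ⇔.trans (∧'-⇔ _ _) (below-⇔ ×-⇔ atCap-⇔) ⟩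
    ((∀ a → toℕ (ℓ a) < B → Exactly (toℕ (ℓ a)) (E a)) ×
     (∀ a → toℕ (ℓ a) ≡ B → AtLeast (toℕ (ℓ a)) (E a)))
      ≈⟨ mk⇔ (λ (below , atCap) a → below a , atCap a) (λ h → proj₁ ∘ h , proj₂ ∘ h) ⟩
    (∀ a → (toℕ (ℓ a) < B → Exactly (toℕ (ℓ a)) (E a)) × (toℕ (ℓ a) ≡ B → AtLeast (toℕ (ℓ a)) (E a)))
      ≈⟨ ∀-cong (λ a → ⇔.sym CappedCount⇔) ⟩
    (∀ a → CappedCount B (ℓ a) (E a)) ∎
    where
    open ⇔-Reasoning
    E : Fin nA → Pred (Dom S) 0ℓ
    E = Event S (classOf S (ρ zero))
    E-⇔ : ∀ a d → Holds S ((suc zero ∼ zero) ∧' lab a zero) (d ∷ᵥ ρ) ⇔ E a d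
    E-⇔ a d = ⇔.trans (∧'-⇔ (suc zero ∼ zero) (lab a zero) {d ∷ᵥ ρ})
                      (mk⇔ (λ (eq , kd) → kd , sym eq) (λ (kd , eq) → sym eq , kd))
    below-⇔ : Holds S (⋀ (concatMap (λ a → when {nA} (toℕ (ℓ a) <ᵇ B)
                                                 (∃= (toℕ (ℓ a)) ((suc zero ∼ zero) ∧' lab a zero)))
                                    (allFin nA))) ρ
              ⇔ (∀ a → toℕ (ℓ a) < B → Exactly (toℕ (ℓ a)) (E a))
    below-⇔ = ⇔.trans (⋀-⇔ _) (⇔.trans (All-concatMap-allFin _) (∀-cong λ a → ⇔.trans (All-when {nA = nA} _)
      (→-cong-⇔ (mk⇔ (<ᵇ⇒< _ _) <⇒<ᵇ)
                (⇔.trans (∃=-⇔ _ _) (AtLeast-cong (≐′-from-⇔ (E-⇔ a)) ×-⇔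
                                     ¬-cong-⇔ (AtLeast-cong (≐′-from-⇔ (E-⇔ a))))))))
    atCap-⇔ : Holds S (⋀ (concatMap (λ a → when {nA} (toℕ (ℓ a) ≡ᵇ B)
                                                 (∃≥ (toℕ (ℓ a)) ((suc zero ∼ zero) ∧' lab a zero)))
                                    (allFin nA))) ρ
              ⇔ (∀ a → toℕ (ℓ a) ≡ B → AtLeast (toℕ (ℓ a)) (E a))
    atCap-⇔ = ⇔.trans (⋀-⇔ _) (⇔.trans (All-concatMap-allFin _) (∀-cong λ a → ⇔.trans (All-when {nA = nA} _)
      (→-cong-⇔ (mk⇔ (≡ᵇ⇒≡ _ _) (≡⇒≡ᵇ _ _))
                (⇔.trans (∃≥-⇔ _ _) (AtLeast-cong (≐′-from-⇔ (E-⇔ a)))))))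

  atom-⇔ : ∀ {B} (⋈ : Bowtie) m θ (ℓ : Fin nA → Fin (suc B)) {ρ : Fin 0 → Dom S} →
           Holds S (atomFormula (nfAtom ⋈ m θ ℓ)) ρ ⇔ Count ⋈ m (HasType B S θ ℓ)
  atom-⇔ {B} ≥' m θ ℓ {ρ} =
    ⇔.trans (∃≥-⇔ m _) (⇔.trans (AtLeast-cong (≐′-from-⇔ has-type-⇔)) (AtLeast-processes S θ _))
    where
    has-type-⇔ : ∀ d → Holds S (typ θ zero ∧' ψ B ℓ) (d ∷ᵥ ρ) ⇔
                       (kind S d ≡ process θ × ∀ a → CappedCount B (ℓ a) (Event S (classOf S d) a))
    has-type-⇔ d = ⇔.trans (∧'-⇔ (typ θ zero) (ψ B ℓ)) (⇔.refl ×-⇔ ψ-⇔ B ℓ)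
  atom-⇔ {B} =' m θ ℓ = ⇔.trans (∧'-⇔ _ _) (atom-⇔ ≥' m θ ℓ ×-⇔ ¬-cong-⇔ (atom-⇔ ≥' (suc m) θ ℓ))

-- Canonical structures

Searchable : Set → Set₁
Searchable X = ∀ (Q : Pred X 0ℓ) → Decidable Q → Dec (Σ X Q)

search-Fin : ∀ {n} → Searchable (Fin n)
search-Fin Q = Finₚ.any?

search-complete : (xs : List X) → (∀ x → x ∈ xs) → Searchable X
search-complete xs complete Q Q? = Dec-map (mk⇔ satisfied (λ (x , Qx) → lose (complete x) Qx)) (Any.any? Q? xs)

search-Σ : {A : Set} {B : A → Set} → Searchable A → (∀ a → Searchable (B a)) → Searchable (Σ A B)
search-Σ {A} {B} search-A search-B Q Q? =
  Dec-map (mk⇔ reassoc unreassoc) (search-A Q′ λ a → search-B a (λ b → Q (a , b)) λ b → Q? (a , b))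
  where
  Q′ : Pred A 0ℓ
  Q′ a = Σ (B a) λ b → Q (a , b)
  reassoc : Σ A Q′ → Σ (Σ A B) Q
  reassoc (a , b , Qab) = (a , b) , Qab
  unreassoc : Σ (Σ A B) Q → Σ A Q′
  unreassoc ((a , b) , Qab) = a , b , Qab

search-⊎ : {A C : Set} → Searchable A → Searchable C → Searchable (A ⊎ C)
search-⊎ search-A search-C Q Q? =
  Dec-map (mk⇔ (λ { (inj₁ (a , Qa)) → inj₁ a , Qa ; (inj₂ (c , Qc)) → inj₂ c , Qc })
               (λ { (inj₁ a , Qa) → inj₁ (a , Qa) ; (inj₂ c , Qc) → inj₂ (c , Qc) }))
          (search-A (Q ∘ inj₁) (Q? ∘ inj₁) ⊎-dec search-C (Q ∘ inj₂) (Q? ∘ inj₂))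

_≟θ_ : DecidableEquality PType
s  ≟θ s  = yes refl
e  ≟θ e  = yes refl
se ≟θ se = yes refl
s  ≟θ e  = no λ ()
s  ≟θ se = no λ ()
e  ≟θ s  = no λ ()
e  ≟θ se = no λ ()
se ≟θ s  = no λ ()
se ≟θ e  = no λ ()

_≟ₖ_ : ∀ {nA} → DecidableEquality (Kind nA)
process θ  ≟ₖ process θ′  = Dec-map (mk⇔ (cong process) process-injective) (θ ≟θ θ′)
position a ≟ₖ position a′ = Dec-map (mk⇔ (cong position) λ { refl → refl }) (a Finₚ.≟ a′)
process _  ≟ₖ position _  = no λ ()
position _ ≟ₖ process _   = no λ ()

module _ {nA : ℕ} (S : Structure nA) (_≟_ : DecidableEquality (Dom S)) (_≟ₚ_ : DecidableEquality (Proc S))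
         (search : Searchable (Dom S)) where

  Holds-dec : ∀ {n} (φ : Formula nA n) (ρ : Fin n → Dom S) → Dec (Holds S φ ρ)
  Holds-dec (typ θ x) ρ = kind S (ρ x) ≟ₖ process θ
  Holds-dec (lab a x) ρ = kind S (ρ x) ≟ₖ position a
  Holds-dec (x ≐ y)   ρ = ρ x ≟ ρ y
  Holds-dec (x ∼ y)   ρ = classOf S (ρ x) ≟ₚ classOf S (ρ y)
  Holds-dec (¬' φ)    ρ = ¬? (Holds-dec φ ρ)
  Holds-dec (φ ∨' ψ)  ρ = Holds-dec φ ρ ⊎-dec Holds-dec ψ ρ
  Holds-dec (∃' φ)    ρ = search _ λ d → Holds-dec φ (d ∷ᵥ ρ)

ptypes : List PType
ptypes = s ∷ e ∷ se ∷ []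

ptypes-complete : ∀ θ → θ ∈ ptypes
ptypes-complete s  = here refl
ptypes-complete e  = there (here refl)
ptypes-complete se = there (there (here refl))

vectors : ∀ k n → List (Vec (Fin k) n)
vectors k zero    = [] ∷ []
vectors k (suc n) = concatMap (λ x → map (x ∷_) (vectors k n)) (allFin k)

vectors-complete : ∀ {k n} (v : Vec (Fin k) n) → v ∈ vectors k n
vectors-complete                 []      = here refl
vectors-complete {k} {suc n} (x ∷ v) =
  ∈-concatMap⁺ (λ y → map (y ∷_) (vectors k n))
               (Any.map (λ { refl → ∈-map⁺ (x ∷_) (vectors-complete v) }) (∈-allFin x))

lookup-injective : ∀ {n} {u v : Vec X n} → lookup u ≗ lookup v → u ≡ v
lookup-injective {u = u} {v} eq =
  trans (sym (Vecₚ.tabulate∘lookup u)) (trans (Vecₚ.tabulate-cong eq) (Vecₚ.tabulate∘lookup v))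

module _ {nA B : ℕ} where

  -- A similarity class of processes: a process type together with a capped event count per action.
  ProcessType : Set
  ProcessType = PType × Vec (Fin (suc B)) nA

  profile : ProcessType → Fin nA → Fin (suc B)
  profile = lookup ∘ proj₂

  HasProcessType : (S : Structure nA) → ProcessType → Pred (Proc S) 0ℓ
  HasProcessType S (θ , ℓ) = HasType B S θ (lookup ℓ)

  processTypes : List ProcessType
  processTypes = cartesianProduct ptypes (vectors (suc B) nA)

  processTypes-complete : ∀ t → t ∈ processTypes
  processTypes-complete (θ , ℓ) = ∈-cartesianProduct⁺ (ptypes-complete θ) (vectors-complete ℓ)

  _≟ₜ_ : DecidableEquality ProcessType
  _≟ₜ_ = Σₚ.≡-dec _≟θ_ (Vecₚ.≡-dec Finₚ._≟_)

  module CanonicalStructure {M : ℕ} (c : ProcessType → Fin (suc M)) where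

    CProc : Set
    CProc = Σ ProcessType λ t → Fin (toℕ (c t))

    CEvent : Set
    CEvent = Σ CProc λ p → Σ (Fin nA) λ a → Fin (toℕ (profile (proj₁ p) a))

    classOfC : CProc ⊎ CEvent → CProc
    classOfC (inj₁ p)       = p
    classOfC (inj₂ (p , _)) = p

    kindC : CProc ⊎ CEvent → Kind nA
    kindC (inj₁ ((θ , _) , _)) = process θ
    kindC (inj₂ (_ , a , _))   = position a

    canonical : Structure nA
    canonical = record
      { Dom = CProc ⊎ CEvent ; Proc = CProc ; classOf = classOfC ; kind = kindC ; typeOf = proj₁ ∘ proj₁
      ; procElem = inj₁
      ; classOf-procElem = λ _ → refl
      ; kind-procElem    = λ _ → refl
      ; procElem-unique  = λ { (inj₁ _) _ _ → refl ; (inj₂ _) _ () }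
      }

    event-count : ∀ p a → Exactly (toℕ (profile (proj₁ p) a)) (Event canonical p a)
    event-count p a =
      Exactly-byBijection (λ i → inj₂ (p , a , i)) (λ { refl → refl }) (λ _ → refl , refl) index index-injective
      where
      index : ∀ d → Event canonical p a d → Fin (toℕ (profile (proj₁ p) a))
      index (inj₂ (_ , _ , i)) (refl , refl) = i
      index-injective : ∀ d d′ ev ev′ → index d ev ≡ index d′ ev′ → d ≡ d′
      index-injective (inj₂ _) (inj₂ _) (refl , refl) (refl , refl) refl = refl

    type-unique : ∀ t p → HasProcessType canonical t p → proj₁ p ≡ t
    type-unique (θ , ℓ) ((θ′ , ℓ′) , i) (refl , counts) =
      cong (θ ,_) (lookup-injective λ a → sym (CappedCount-unique (event-count ((θ , ℓ′) , i) a) (counts a)))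

    type-count : ∀ t → Exactly (toℕ (c t)) (HasProcessType canonical t)
    type-count t = Exactly-byBijection (t ,_) (λ { refl → refl })
                     (λ i → refl , λ a → Exactly⇒CappedCount (event-count (t , i) a)) index index-injective
      where
      index : ∀ p → HasProcessType canonical t p → Fin (toℕ (c t))
      index (t′ , i) h with type-unique t (t′ , i) h
      ... | refl = i
      index-injective : ∀ p p′ h h′ → index p h ≡ index p′ h′ → p ≡ p′
      index-injective (t₁ , i₁) (t₂ , i₂) h h′ eq with type-unique t (t₁ , i₁) h | type-unique t (t₂ , i₂) h′
      index-injective (t₁ , i₁) (t₂ , i₂) h h′ refl | refl | refl = refl

    canonical-counts : ∀ t → CappedCount M (c t) (HasProcessType canonical t)
    canonical-counts t = Exactly⇒CappedCount (type-count t)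

    Holds-canonical-dec : ∀ {n} (φ : Formula nA n) (ρ : Fin n → CProc ⊎ CEvent) → Dec (Holds canonical φ ρ)
    Holds-canonical-dec =
      Holds-dec canonical (⊎ₚ.≡-dec _≟ₚ_ (Σₚ.≡-dec _≟ₚ_ (Σₚ.≡-dec Finₚ._≟_ Finₚ._≟_))) _≟ₚ_
                (search-⊎ search-CProc (search-Σ search-CProc λ _ → search-Σ search-Fin λ _ → search-Fin))
      where
      _≟ₚ_ : DecidableEquality CProc
      _≟ₚ_ = Σₚ.≡-dec _≟ₜ_ Finₚ._≟_
      search-CProc : Searchable CProc
      search-CProc = search-Σ (search-complete processTypes processTypes-complete) λ _ → search-Fin

module _ (_≟_ : DecidableEquality X) {m : ℕ} where

  update : X → Fin (suc m) → (X → Fin (suc m)) → X → Fin (suc m)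
  update x v f y with y ≟ x
  ... | yes _ = v
  ... | no  _ = f y

  functions : List X → List (X → Fin (suc m))
  functions []       = (λ _ → zero) ∷ []
  functions (x ∷ xs) = concatMap (λ v → map (update x v) (functions xs)) (allFin (suc m))

  functions-complete : ∀ (g : X → Fin (suc m)) xs →
                       Σ (X → Fin (suc m)) λ f → f ∈ functions xs × (∀ x → x ∈ xs → f x ≡ g x)
  functions-complete g []       = (λ _ → zero) , here refl , λ _ ()
  functions-complete g (x ∷ xs) with functions-complete g xs
  ... | f , f∈ , f≗g =
    update x (g x) f ,
    ∈-concatMap⁺ (λ v → map (update x v) (functions xs))
                 (Any.map (λ { refl → ∈-map⁺ (update x (g x)) f∈ }) (∈-allFin (g x))) ,
    agrees
    where
    agrees : ∀ y → y ∈ x ∷ xs → update x (g x) f y ≡ g y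
    agrees y y∈ with y ≟ x
    agrees y (here refl) | no y≢x = ⊥-elim (y≢x refl)
    agrees y (there y∈)  | no _   = f≗g y y∈
    ... | yes refl = refl

module NormalFormOf {nA : ℕ} (φ : Formula nA 0) where

  CountFunction : Set
  CountFunction = ProcessType {nA} {rank φ} → Fin (suc (rank φ))

  open CanonicalStructure {nA} {rank φ} {rank φ}

  atom : CountFunction → ProcessType → NFAtom nA (rank φ)
  atom c t = nfAtom (capBowtie (rank φ) (c t)) (toℕ (c t)) (proj₁ t) (profile t)

  conjunction : CountFunction → List (NFAtom nA (rank φ))
  conjunction c = map (atom c) processTypes

  isModel? : ∀ c → Dec (Holds (canonical c) φ []ᵥ)
  isModel? c = Holds-canonical-dec c φ []ᵥ

  models : List CountFunction
  models = filter isModel? (functions _≟ₜ_ processTypes)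

  normalForm : NormalForm nA (rank φ)
  normalForm = map conjunction models

  Counts : CountFunction → Structure nA → Set
  Counts c S = ∀ t → CappedCount (rank φ) (c t) (HasProcessType S t)

  module _ (em : ExcludedMiddle 0ℓ) (S : Structure nA) {ρ : Fin 0 → Dom S} where
    open Connectives em S

    conjunction-⇔ : ∀ c → Holds S (⋀ (map atomFormula (conjunction c))) ρ ⇔ Counts c S
    conjunction-⇔ c = begin
      Holds S (⋀ (map atomFormula (conjunction c))) ρ
        ≈⟨ ⇔.trans (⋀-⇔ _) (mk⇔ (Allₚ.map⁻ ∘ Allₚ.map⁻) (Allₚ.map⁺ ∘ Allₚ.map⁺)) ⟩
      All (λ t → Holds S (atomFormula (atom c t)) ρ) processTypes
        ≈⟨ All-complete processTypes-complete ⟩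
      (∀ t → Holds S (atomFormula (atom c t)) ρ)
        ≈⟨ ∀-cong (λ t → ⇔.trans (atom-⇔ _ _ _ _) (⇔.sym CappedCount⇔Count)) ⟩
      Counts c S ∎
      where open ⇔-Reasoning

    normalForm-⇔ : Holds S (nfFormula normalForm) ρ ⇔ Σ CountFunction (λ c → c ∈ models × Counts c S)
    normalForm-⇔ = begin
      Holds S (nfFormula normalForm) ρ
        ≈⟨ ⇔.trans (⋁-⇔ _) (mk⇔ (Anyₚ.map⁻ ∘ Anyₚ.map⁻) (Anyₚ.map⁺ ∘ Anyₚ.map⁺)) ⟩
      Any (λ c → Holds S (⋀ (map atomFormula (conjunction c))) ρ) models
        ≈⟨ ⇔.trans Any⇔∈ (∃-cong λ c → ⇔.refl ×-⇔ conjunction-⇔ c) ⟩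
      Σ CountFunction (λ c → c ∈ models × Counts c S) ∎
      where open ⇔-Reasoning

    Holds⇔canonical : ∀ {c} → Counts c S → Holds S φ ρ ⇔ Holds (canonical c) φ []ᵥ
    Holds⇔canonical {c} S-counts = Invariant⇒Holds⇔ em φ (Invariant-[] em same-types) ≤-refl
      where
      same-types : ∀ θ ℓ → Agree (rank φ) (HasProcessType S (θ , ℓ)) (HasProcessType (canonical c) (θ , ℓ))
      same-types θ ℓ = CappedCount⇒Agree (S-counts (θ , ℓ)) (canonical-counts c (θ , ℓ))

    cappedCounts : (t : ProcessType {nA} {rank φ}) →
                   Σ (Fin (suc (rank φ))) λ v → CappedCount (rank φ) v (HasProcessType S t)
    cappedCounts t = cappedCount em (HasProcessType S t) (rank φ)

    counts : Σ CountFunction λ c → c ∈ functions _≟ₜ_ processTypes × Counts c S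
    counts with functions-complete _≟ₜ_ (proj₁ ∘ cappedCounts) processTypes
    ... | c , c∈ , c≗ = c , c∈ , λ t → subst (λ v → CappedCount (rank φ) v (HasProcessType S t))
                                             (sym (c≗ t (processTypes-complete t))) (proj₂ (cappedCounts t))

    normalForm-correct : Holds S φ ρ ⇔ Holds S (nfFormula normalForm) ρ
    normalForm-correct = mk⇔
      (λ h → let c , c∈ , S-counts = counts in
             from normalForm-⇔ (c , ∈-filter⁺ isModel? c∈ (to (Holds⇔canonical S-counts) h) , S-counts))
      (λ h → let c , c∈ , S-counts = to normalForm-⇔ h in
             from (Holds⇔canonical S-counts) (proj₂ (∈-filter⁻ isModel? {xs = functions _≟ₜ_ processTypes} c∈)))

theorem2 : {nA : ℕ} (side : Fin nA → Side) (φ : Formula nA 0) →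
    Σ ℕ λ B → Σ (NormalForm nA B) λ nf →
      ExcludedMiddle 0ℓ →
      {np : ℕ} (ptype : Fin np → PType) (w : Execution side ptype) →
      Semantics._⊨_ w φ ⇔ Semantics._⊨_ w (nfFormula nf)
theorem2 side φ = rank φ , normalForm , λ em ptype w →
  ⇔.trans (Sat⇔Holds w φ _)
 (⇔.trans (normalForm-correct em (executionStructure w))
          (⇔.sym (Sat⇔Holds w (nfFormula normalForm) _)))
  where open NormalFormOf φ
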